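{- For each positive integer $z$, there exists a positive integer $n$ such that whenever $V(G_n)=A\cup B$ is a bipartition of $G_n$ (i.e. $A,B$ disjoint independent sets covering $\{1,\dots,n\}$), we have $\left||A|-\tfrac{n}{2}\right|=z$.
   Context: The Fibonacci numbers are defined by $F_0=0$, $F_1=1$ and $F_m=F_{m-1}+F_{m-2}$ for $m\geq 2$. For each integer $n\geq 1$, the Fibonacci-sum graph $G_n$ is the simple graph with vertex set $\{1,2,\dots,n\}$ in which distinct vertices $i,j$ are adjacent if and only if $i+j$ is a Fibonacci number. (Each $G_n$ is bipartite.) -}

module Defs where

open import Data.Nat using (ℕ; zero; suc; _+_; _≤_; _<_)
open import Data.Bool using (Bool; true; false)
open import Data.Product using (∃-syntax; _×_)
open import Data.Empty using (⊥)
open import Relation.Binary.PropositionalEquality using (_≡_; _≢_)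

fib : ℕ → ℕ
fib zero = 0
fib (suc zero) = 1
fib (suc (suc m)) = fib (suc m) + fib m

IsFib : ℕ → Set
IsFib k = ∃[ m ] fib m ≡ k

Adj : ℕ → ℕ → ℕ → Set
Adj n i j = (1 ≤ i) × (i ≤ n) × (1 ≤ j) × (j ≤ n) × (i ≢ j) × IsFib (i + j)

-- A bipartition V(G_n) = A ∪ B is given by its indicator c : A = {i ∈ [1,n] : c i = true},
-- B = {i ∈ [1,n] : c i = false}. These are disjoint and cover [1,n] automatically;
-- the condition is that both A and B are independent, i.e. adjacent vertices get different colours.
IsBipartition : ℕ → (ℕ → Bool) → Set
IsBipartition n c = ∀ i j → Adj n i j → c i ≢ c j

countA : (ℕ → Bool) → ℕ → ℕ
countA c zero = 0
countA c (suc n) with c (suc n)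
... | true  = suc (countA c n)
... | false = countA c n

module Submission where

-- Let h be the sequence 1, 4, 17, 72, … given by h (k+2) = 4·h (k+1) + h k.
-- Then 2·h k = F (3k+3) and h k + h (k+1) = F (3k+5), so 1 = h 0, h 1, h 2, … is a
-- path in every G_n that contains it; hence in a bipartition all "centres" h (2t)
-- receive the colour of 1.  A centre m with m + m a Fibonacci number makes the segment
-- [m-e, m+e] count-symmetric: the mirror pairs (m-i, m+i) are edges, so each pair
-- contributes exactly one vertex to A, and only m itself is unpaired.
-- Tiling [1, n] by consecutive such segments around the centres h 0, h 2, h 4, …
-- (each segment starts right after the previous one ends) therefore gives, after t
-- segments, exactly t unpaired vertices, all of the colour of 1: so 2·|A| − n = ± t.
-- Taking t = 2z and n = the right end of the t-th segment yields | |A| − n/2 | = z;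
-- the last step is a small computation in ℚ.

open import Defs
open import Data.Nat using (ℕ; zero; suc; _+_; _*_; _∸_; _≤_; _<_; _≥_; z≤n; s≤s)
open import Data.Nat.Properties
  using (+-suc; +-assoc; +-identityʳ; +-comm; +-cancelʳ-≡; *-cancelˡ-≡; m≤m+n; m≤n+m; m<m+n;
         m+[n∸m]≡n; m+n∸m≡n; ≤-refl; ≤-trans; <-≤-trans; <⇒≤; <⇒≢; +-mono-≤;
         module ≤-Reasoning)
open import Data.Nat.Tactic.RingSolver using (solve-∀)
open import Data.Bool using (Bool; true; false)
open import Data.Product using (∃-syntax; _×_; _,_)
open import Data.Empty using (⊥-elim)
open import Data.Integer as ℤ using (+_; _⊖_)
import Data.Integer.Properties as ℤP
open import Data.Rational using (_/_; _-_; ∣_∣; toℚᵘ)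
import Data.Rational as ℚ
open import Data.Rational.Properties
  using (toℚᵘ-injective; toℚᵘ-homo-∣-∣; toℚᵘ-homo-+; toℚᵘ-homo‿-; toℚᵘ-fromℚᵘ)
open import Data.Rational.Unnormalised as ℚᵘ using (mkℚᵘ; *≡*)
import Data.Rational.Unnormalised.Properties as ℚᵘP
open import Relation.Binary.PropositionalEquality
  using (_≡_; _≢_; refl; sym; trans; cong; cong₂; subst; module ≡-Reasoning)

indicator : Bool → ℕ
indicator true  = 1
indicator false = 0

countA-suc : ∀ c n → countA c (suc n) ≡ countA c n + indicator (c (suc n))
countA-suc c n with c (suc n)
... | true  = +-comm 1 (countA c n)
... | false = sym (+-identityʳ (countA c n))

indicator-opposite : ∀ {a b : Bool} → a ≢ b → indicator a + indicator b ≡ 1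
indicator-opposite {true}  {true}  a≢b = ⊥-elim (a≢b refl)
indicator-opposite {true}  {false} _   = refl
indicator-opposite {false} {true}  _   = refl
indicator-opposite {false} {false} a≢b = ⊥-elim (a≢b refl)

two-steps-same : ∀ {a b d : Bool} → a ≢ b → b ≢ d → a ≡ d
two-steps-same {true}  {true}          a≢b _   = ⊥-elim (a≢b refl)
two-steps-same {false} {false}         a≢b _   = ⊥-elim (a≢b refl)
two-steps-same {true}  {false} {true}  _   _   = refl
two-steps-same {true}  {false} {false} _   b≢d = ⊥-elim (b≢d refl)
two-steps-same {false} {true}  {false} _   _   = refl
two-steps-same {false} {true}  {true}  _   b≢d = ⊥-elim (b≢d refl)

adjacent : ∀ {n i j} → 1 ≤ i → i < j → j ≤ n → IsFib (i + j) → Adj n i j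
adjacent 1≤i i<j j≤n fib-sum =
  1≤i , ≤-trans (<⇒≤ i<j) j≤n , ≤-trans 1≤i (<⇒≤ i<j) , j≤n , <⇒≢ i<j , fib-sum

fib-shift3 : ∀ n → fib n + fib (3 + n) ≡ fib (2 + n) + fib (2 + n)
fib-shift3 n = identity (fib n) (fib (suc n))
  where
  identity : ∀ u v → u + ((v + u) + v) ≡ (v + u) + (v + u)
  identity = solve-∀

fib-step6 : ∀ n → fib (6 + n) ≡ 4 * fib (3 + n) + fib n
fib-step6 n = identity (fib n) (fib (suc n))
  where
  identity : ∀ u v →
    ((((v + u) + v) + (v + u)) + ((v + u) + v)) + (((v + u) + v) + (v + u))
      ≡ 4 * ((v + u) + v) + u
  identity = solve-∀

-- h k = F (3k+3) / 2; the recurrence mirrors F (m+6) = 4·F (m+3) + F m.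
h : ℕ → ℕ
h zero                = 1
h (suc zero)          = 4
h (suc (suc k))       = 4 * h (suc k) + h k

h-double : ∀ k → h k + h k ≡ fib (3 + k * 3)
h-double zero          = refl
h-double (suc zero)    = refl
h-double (suc (suc k)) = begin
  h (2 + k) + h (2 + k)                              ≡⟨ regroup (h (suc k)) (h k) ⟩
  4 * (h (suc k) + h (suc k)) + (h k + h k)          ≡⟨ cong (λ x → 4 * x + (h k + h k)) (h-double (suc k)) ⟩
  4 * fib (6 + k * 3) + (h k + h k)                  ≡⟨ cong (λ x → 4 * fib (6 + k * 3) + x) (h-double k) ⟩
  4 * fib (6 + k * 3) + fib (3 + k * 3)              ≡⟨ sym (fib-step6 (3 + k * 3)) ⟩
  fib (9 + k * 3)                                    ∎
  where
  open ≡-Reasoning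
  regroup : ∀ x y → (4 * x + y) + (4 * x + y) ≡ 4 * (x + x) + (y + y)
  regroup = solve-∀

h-path : ∀ k → IsFib (h k + h (suc k))
h-path k = 5 + k * 3 , halve (begin
  fib (5 + k * 3) + fib (5 + k * 3)                  ≡⟨ sym (fib-shift3 (3 + k * 3)) ⟩
  fib (3 + k * 3) + fib (6 + k * 3)                  ≡⟨ cong₂ _+_ (sym (h-double k)) (sym (h-double (suc k))) ⟩
  (h k + h k) + (h (suc k) + h (suc k))              ≡⟨ regroup (h k) (h (suc k)) ⟩
  (h k + h (suc k)) + (h k + h (suc k))              ∎)
  where
  open ≡-Reasoning
  regroup : ∀ x y → (x + x) + (y + y) ≡ (x + y) + (x + y)
  regroup = solve-∀
  halve : ∀ {a b} → a + a ≡ b + b → a ≡ b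
  halve {a} {b} eq = *-cancelˡ-≡ a b 2 (trans (twice a) (trans eq (sym (twice b))))
    where
    twice : ∀ x → 2 * x ≡ x + x
    twice = solve-∀

h-positive : ∀ k → 1 ≤ h k
h-positive zero          = s≤s z≤n
h-positive (suc zero)    = s≤s z≤n
h-positive (suc (suc k)) = ≤-trans (h-positive k) (m≤n+m (h k) _)

h-increasing : ∀ k → h k < h (suc k)
h-increasing zero    = s≤s (s≤s z≤n)
h-increasing (suc k) = <-≤-trans (m<m+n (h (suc k)) (h-positive k))
                                 (+-mono-≤ (m≤m+n (h (suc k)) _) ≤-refl)

-- 2·h k ≤ h (k+2): a segment mirrored about one centre ends before the next centre.
h-double-≤ : ∀ k → h k + h k ≤ h (suc (suc k))
h-double-≤ k = +-mono-≤ (≤-trans (<⇒≤ (h-increasing k)) (m≤m+n (h (suc k)) _)) ≤-refl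

centre : ℕ → ℕ
centre t = h (t * 2)

centre-fib : ∀ t → IsFib (centre t + centre t)
centre-fib t = 3 + t * 2 * 3 , sym (h-double (t * 2))

-- The tiling of [1, ∞) by segments symmetric about the centres:
-- segment t is (bound t, bound (suc t)], of radius (radius t) about centre t.

bound  : ℕ → ℕ
radius : ℕ → ℕ
bound zero    = 0
bound (suc t) = radius t + centre t
radius t = centre t ∸ suc (bound t)

bound<centre : ∀ t → bound t < centre t
centre-split : ∀ t → suc (bound t + radius t) ≡ centre t
centre-split t = m+[n∸m]≡n (bound<centre t)

bound<centre zero    = h-positive 0
bound<centre (suc t) = begin-strict
  radius t + centre t              <⟨ +-mono-≤ radius<centre ≤-refl ⟩
  centre t + centre t              ≤⟨ h-double-≤ (t * 2) ⟩
  centre (suc t)                   ∎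
  where
  open ≤-Reasoning
  radius<centre : radius t < centre t
  radius<centre = subst (radius t <_) (centre-split t) (s≤s (m≤n+m (radius t) (bound t)))

bound-positive : ∀ t → 1 ≤ bound (suc t)
bound-positive t = ≤-trans (h-positive (t * 2)) (m≤n+m (centre t) (radius t))

-- Bookkeeping for one more segment: it adds radius pairs and one unpaired vertex.
imbalance-step : ∀ C M r i t → C * 2 + t ≡ M + t * i * 2 →
  (C + r + i) * 2 + suc t ≡ (r + suc (M + r)) + suc t * i * 2
imbalance-step C M r i t inv = begin
  (C + r + i) * 2 + suc t                      ≡⟨ split C r i t ⟩
  (C * 2 + t) + (r * 2 + i * 2 + 1)            ≡⟨ cong (_+ (r * 2 + i * 2 + 1)) inv ⟩
  (M + t * i * 2) + (r * 2 + i * 2 + 1)        ≡⟨ join M r i t ⟩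
  (r + suc (M + r)) + suc t * i * 2            ∎
  where
  open ≡-Reasoning
  split : ∀ C r i t → (C + r + i) * 2 + suc t ≡ (C * 2 + t) + (r * 2 + i * 2 + 1)
  split = solve-∀
  join : ∀ M r i t → (M + t * i * 2) + (r * 2 + i * 2 + 1) ≡ (r + suc (M + r)) + suc t * i * 2
  join = solve-∀

module Bipartition {n : ℕ} {c : ℕ → Bool} (bipartite : IsBipartition n c) where

  mirror-pair : ∀ {i j} → 1 ≤ i → i < j → j ≤ n → IsFib (i + j) →
                indicator (c i) + indicator (c j) ≡ 1
  mirror-pair 1≤i i<j j≤n fib-sum =
    indicator-opposite (bipartite _ _ (adjacent 1≤i i<j j≤n fib-sum))

  segment-count : ∀ {m} e a → suc (a + e) ≡ m → IsFib (m + m) → e + m ≤ n →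
                  countA c (e + m) ≡ countA c a + e + indicator (c m)
  segment-count zero a refl _ _
    rewrite +-identityʳ a | +-identityʳ (countA c a) = countA-suc c a
  segment-count {m} (suc e) a centred fib-m top≤n = begin
    countA c (suc e + m)                                   ≡⟨ countA-suc c (e + m) ⟩
    countA c (e + m) + iₜ                                  ≡⟨ cong (_+ iₜ) inner ⟩
    (countA c (suc a) + e + iₘ) + iₜ                       ≡⟨ cong (λ x → (x + e + iₘ) + iₜ) (countA-suc c a) ⟩
    ((countA c a + iₐ) + e + iₘ) + iₜ                      ≡⟨ regroup (countA c a) iₐ iₜ e iₘ ⟩
    countA c a + (iₐ + iₜ) + e + iₘ                        ≡⟨ cong (λ x → countA c a + x + e + iₘ) outer ⟩
    countA c a + 1 + e + iₘ                                ≡⟨ one-more (countA c a) e iₘ ⟩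
    countA c a + suc e + iₘ                                ∎
    where
    open ≡-Reasoning
    iₐ = indicator (c (suc a))
    iₜ = indicator (c (suc e + m))
    iₘ = indicator (c m)
    inner : countA c (e + m) ≡ countA c (suc a) + e + indicator (c m)
    inner = segment-count e (suc a) (trans (cong suc (sym (+-suc a e))) centred) fib-m
                          (<⇒≤ top≤n)
    pair-sum : suc a + (suc e + m) ≡ m + m
    pair-sum = trans (sym (+-assoc (suc a) (suc e) m)) (cong (_+ m) centred)
    a<top : suc a < suc e + m
    a<top = s≤s (≤-trans (subst (a <_) centred (s≤s (m≤m+n a (suc e)))) (m≤n+m m e))
    outer : iₐ + iₜ ≡ 1
    outer = mirror-pair (s≤s z≤n) a<top top≤n (subst IsFib (sym pair-sum) fib-m)
    regroup : ∀ C x y e i → ((C + x) + e + i) + y ≡ C + (x + y) + e + i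
    regroup = solve-∀
    one-more : ∀ C e i → C + 1 + e + i ≡ C + suc e + i
    one-more = solve-∀

  same-colour-two-apart : ∀ k → h (suc (suc k)) ≤ n → c (h k) ≡ c (h (suc (suc k)))
  same-colour-two-apart k h₂≤n =
    two-steps-same (bipartite _ _ (adjacent (h-positive k) (h-increasing k) h₁≤n (h-path k)))
                   (bipartite _ _ (adjacent (h-positive (suc k)) (h-increasing (suc k)) h₂≤n
                                            (h-path (suc k))))
    where
    h₁≤n : h (suc k) ≤ n
    h₁≤n = ≤-trans (<⇒≤ (h-increasing (suc k))) h₂≤n

  centre-colour : ∀ t → centre t ≤ n → c (centre t) ≡ c 1
  centre-colour zero    _  = refl
  centre-colour (suc t) le =
    trans (sym (same-colour-two-apart (t * 2) le))
          (centre-colour t (≤-trans (≤-trans (m≤m+n (centre t) _) (h-double-≤ (t * 2))) le))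

  -- After t segments, the t unpaired centres all lie on the side of 1:
  -- 2·|A ∩ [1, bound t]| + t = bound t + 2t·[1 ∈ A].
  imbalance : ∀ t → bound t ≤ n →
              countA c (bound t) * 2 + t ≡ bound t + t * indicator (c 1) * 2
  imbalance zero    _       = refl
  imbalance (suc t) bound≤n = begin
    countA c (bound (suc t)) * 2 + suc t                    ≡⟨ cong (λ x → x * 2 + suc t) segment ⟩
    (countA c (bound t) + radius t + i₁) * 2 + suc t        ≡⟨ imbalance-step (countA c (bound t)) (bound t) (radius t) i₁ t (imbalance t previous≤n) ⟩
    radius t + suc (bound t + radius t) + suc t * i₁ * 2    ≡⟨ cong (λ x → radius t + x + suc t * i₁ * 2) (centre-split t) ⟩
    bound (suc t) + suc t * i₁ * 2                          ∎
    where
    open ≡-Reasoning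
    i₁ = indicator (c 1)
    centre≤n : centre t ≤ n
    centre≤n = ≤-trans (m≤n+m (centre t) (radius t)) bound≤n
    previous≤n : bound t ≤ n
    previous≤n = ≤-trans (<⇒≤ (bound<centre t)) centre≤n
    segment : countA c (bound (suc t)) ≡ countA c (bound t) + radius t + i₁
    segment = trans (segment-count (radius t) (bound t) (centre-split t) (centre-fib t) bound≤n)
                    (cong (λ b → countA c (bound t) + radius t + indicator b) (centre-colour t centre≤n))

gap : ∀ b k M t → k * 2 + t ≡ M + t * indicator b * 2 → ℤ.∣ (k * 2) ⊖ M ∣ ≡ t
gap true k M t balance = begin
  ℤ.∣ (k * 2) ⊖ M ∣          ≡⟨ cong (λ x → ℤ.∣ x ⊖ M ∣) doubled ⟩
  ℤ.∣ (M + t) ⊖ M ∣          ≡⟨ cong ℤ.∣_∣ (ℤP.⊖-≥ (m≤m+n M t)) ⟩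
  M + t ∸ M                  ≡⟨ m+n∸m≡n M t ⟩
  t                          ∎
  where
  open ≡-Reasoning
  rhs : ∀ M t → M + t * 1 * 2 ≡ (M + t) + t
  rhs = solve-∀
  doubled : k * 2 ≡ M + t
  doubled = +-cancelʳ-≡ t (k * 2) (M + t) (trans balance (rhs M t))
gap false k M t balance = begin
  ℤ.∣ (k * 2) ⊖ M ∣          ≡⟨ cong (λ x → ℤ.∣ (k * 2) ⊖ x ∣) (sym whole) ⟩
  ℤ.∣ (k * 2) ⊖ (k * 2 + t) ∣ ≡⟨ ℤP.∣⊖∣-≤ (m≤m+n (k * 2) t) ⟩
  k * 2 + t ∸ k * 2          ≡⟨ m+n∸m≡n (k * 2) t ⟩
  t                          ∎
  where
  open ≡-Reasoning
  rhs : ∀ M t → M + t * 0 * 2 ≡ M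
  rhs = solve-∀
  whole : k * 2 + t ≡ M
  whole = trans balance (rhs M t)

half-gap : ∀ k M d → ℤ.∣ (k * 2) ⊖ M ∣ ≡ d * 2 → ∣ (+ k) / 1 - (+ M) / 2 ∣ ≡ (+ d) / 1
half-gap k M d gap₂ = toℚᵘ-injective (begin
  toℚᵘ ∣ (+ k) / 1 - (+ M) / 2 ∣           ≈⟨ toℚᵘ-homo-∣-∣ ((+ k) / 1 - (+ M) / 2) ⟩
  ℚᵘ.∣ toℚᵘ ((+ k) / 1 - (+ M) / 2) ∣      ≈⟨ ℚᵘP.∣-∣-cong unnormalise ⟩
  ℚᵘ.∣ difference ∣                         ≈⟨ *≡* absolute-numerator ⟩
  mkℚᵘ (+ d) 0                              ≈⟨ ℚᵘP.≃-sym (toℚᵘ-fromℚᵘ (mkℚᵘ (+ d) 0)) ⟩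
  toℚᵘ ((+ d) / 1)                          ∎)
  where
  open ℚᵘP.≃-Reasoning
  difference : ℚᵘ.ℚᵘ
  difference = mkℚᵘ (+ k) 0 ℚᵘ.- mkℚᵘ (+ M) 1
  unnormalise : toℚᵘ ((+ k) / 1 - (+ M) / 2) ℚᵘ.≃ difference
  unnormalise = ℚᵘP.≃-trans (toℚᵘ-homo-+ ((+ k) / 1) (ℚ.- ((+ M) / 2)))
    (ℚᵘP.+-cong (toℚᵘ-fromℚᵘ (mkℚᵘ (+ k) 0))
                (ℚᵘP.≃-trans (toℚᵘ-homo‿- ((+ M) / 2)) (ℚᵘP.-‿cong (toℚᵘ-fromℚᵘ (mkℚᵘ (+ M) 1)))))
  numerator : ℚᵘ.ℚᵘ.numerator difference ≡ (k * 2) ⊖ M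
  numerator = trans (cong₂ ℤ._+_ (sym (ℤP.pos-* k 2)) (ℤP.*-identityʳ (ℤ.- (+ M))))
                    (ℤP.m-n≡m⊖n (k * 2) M)
  absolute-numerator : + ℤ.∣ ℚᵘ.ℚᵘ.numerator difference ∣ ℤ.* + 1 ≡ + d ℤ.* + 2
  absolute-numerator = trans (ℤP.*-identityʳ _)
    (trans (cong (λ x → + ℤ.∣ x ∣) numerator) (trans (cong +_ gap₂) (ℤP.pos-* d 2)))

theorem8 : (z : ℕ) → z ≥ 1 →
    ∃[ n ] (n ≥ 1 × ((c : ℕ → Bool) → IsBipartition n c →
    ∣ (+ countA c n) / 1 - (+ n) / 2 ∣ ≡ (+ z) / 1))
theorem8 zero    ()
theorem8 (suc y) _ = bound (z * 2) , bound-positive (suc (y * 2)) , distance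
  where
  z = suc y
  distance : (c : ℕ → Bool) → IsBipartition (bound (z * 2)) c →
             ∣ (+ countA c (bound (z * 2))) / 1 - (+ bound (z * 2)) / 2 ∣ ≡ (+ z) / 1
  distance c bipartite =
    half-gap (countA c (bound (z * 2))) (bound (z * 2)) z
      (gap (c 1) (countA c (bound (z * 2))) (bound (z * 2)) (z * 2) (Bipartition.imbalance bipartite (z * 2) ≤-refl))
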